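{- For any odd integer $p$ and every integer $k$, $$ s_{k+p}(n)-s_k(n)=\mathcal{T}_{k+\frac{p+1}{2}}(n)\, s_{(p-1)/2}(n). $$
   Context: The sequence $(s_k(n))_{k\in\mathbb{Z}}$ is defined by $s_0(n)=1$, $s_1(n)=n+1$ and $s_{k+2}(n)=n\,s_{k+1}(n)-s_k(n)$ for all $k\in\mathbb{Z}$. The dilated Chebyshev polynomials of the first kind $\mathcal{T}_k$ ($k\in\mathbb{Z}$) are defined by $\mathcal{T}_k(2\cos\theta)=2\cos(k\theta)$; equivalently $\mathcal{T}_0=2$, $\mathcal{T}_1(x)=x$, $\mathcal{T}_{k+2}(x)=x\,\mathcal{T}_{k+1}(x)-\mathcal{T}_k(x)$. -}

module Defs where

open import Data.Nat using (ℕ; zero; suc)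
open import Data.Integer using (ℤ; +_; -[1+_]; _+_; _-_; _*_; -_)

-- Used for both directions: the recurrence x_{k+2} = x x_{k+1} - x_k read
-- backwards (x_k = x x_{k+1} - x_{k+2}) gives the same recurrence for m ↦ u_{-m}.
rec : ℤ → ℤ → ℤ → ℕ → ℤ
rec x a b zero = a
rec x a b (suc zero) = b
rec x a b (suc (suc m)) = x * rec x a b (suc m) - rec x a b m

-- s_k(n), k ∈ ℤ : s_0 = 1, s_1 = n+1, s_{k+2} = n s_{k+1} - s_k for all k ∈ ℤ.
-- Backwards: s_0 = 1, s_{-1} = n s_0 - s_1 = -1.
s : ℤ → ℤ → ℤ
s (+ m) n = rec n (+ 1) (n + + 1) m
s -[1+ m ] n = rec n (+ 1) (- + 1) (suc m)

-- Dilated Chebyshev polynomials of the first kind 𝒯_k(x), k ∈ ℤ: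
-- 𝒯_0 = 2, 𝒯_1 = x, 𝒯_{k+2} = x 𝒯_{k+1} - 𝒯_k for all k ∈ ℤ.
-- Backwards: 𝒯_0 = 2, 𝒯_{-1} = x 𝒯_0 - 𝒯_1 = x.
𝒯 : ℤ → ℤ → ℤ
𝒯 (+ m) x = rec x (+ 2) x m
𝒯 -[1+ m ] x = rec x (+ 2) x (suc m)

-- A two-sided solution u : ℤ → ℤ of u (k + 2) = x u (k + 1) - u k is determined by u 0
-- and u 1, and such solutions are closed under shifts k ↦ c + k, reflections k ↦ c - k,
-- sums, negation and scaling. Comparing values at a = 0, 1 thus gives
-- 𝒯_a s_b = s_{b+a} + s_{b-a} and s_{-1-k} = -s_k; with a = k + (p+1)/2 and
-- b = (p-1)/2 these combine to the proposition.

module Submission where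

open import Defs
open import Data.Nat using (zero; suc)
import Data.Nat.Properties as ℕ
open import Data.Integer using (ℤ; +_; -[1+_]; _+_; _-_; _*_; -_)
open import Data.Integer.Properties using (+-assoc; +-identityʳ)
open import Data.Integer.Tactic.RingSolver using (solve-∀)
open import Data.Product using (_×_; _,_; proj₁)
open import Relation.Binary.PropositionalEquality
open ≡-Reasoning

record Recurrent (x : ℤ) (f : ℤ → ℤ) : Set where
  constructor recurrent
  field step : ∀ k → f (k + + 2) ≡ x * f (k + + 1) - f k

open Recurrent

module _ {x : ℤ} {f : ℤ → ℤ} (rf : Recurrent x f) where

  recurrent-at : ∀ {i j k} → j ≡ i + + 1 → k ≡ i + + 2 → f k ≡ x * f j - f i
  recurrent-at {i} refl refl = step rf i

  recurrent-backward : ∀ {i j k} → j ≡ i + + 1 → k ≡ i + + 2 → f i ≡ x * f j - f k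
  recurrent-backward {i} {j} {k} j≡ k≡ = begin
    f i                         ≡⟨ swap (f i) (x * f j) ⟩
    x * f j - (x * f j - f i)   ≡⟨ cong (λ u → x * f j - u) (recurrent-at j≡ k≡) ⟨
    x * f j - f k               ∎
    where
    swap : ∀ a b → a ≡ b - (b - a)
    swap = solve-∀

  recurrent-shift : ∀ c → Recurrent x (λ k → f (c + k))
  recurrent-shift c = recurrent λ k → recurrent-at (assoc k) (assoc k)
    where
    assoc : ∀ {d} k → c + (k + d) ≡ c + k + d
    assoc {d} k = sym (+-assoc c k d)

  recurrent-reflect : ∀ c → Recurrent x (λ k → f (c - k))
  recurrent-reflect c = recurrent λ k → recurrent-backward (shift₁ c k) (shift₂ c k)
    where
    shift₁ : ∀ c k → c - (k + + 1) ≡ c - (k + + 2) + + 1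
    shift₁ = solve-∀
    shift₂ : ∀ c k → c - k ≡ c - (k + + 2) + + 2
    shift₂ = solve-∀

  recurrent-*ʳ : ∀ c → Recurrent x (λ k → f k * c)
  recurrent-*ʳ c = recurrent λ k → begin
    f (k + + 2) * c                        ≡⟨ cong (_* c) (step rf k) ⟩
    (x * f (k + + 1) - f k) * c            ≡⟨ distrib x (f (k + + 1)) (f k) c ⟩
    x * (f (k + + 1) * c) - f k * c        ∎
    where
    distrib : ∀ x a b c → (x * a - b) * c ≡ x * (a * c) - b * c
    distrib = solve-∀

  recurrent-neg : Recurrent x (λ k → - f k)
  recurrent-neg = recurrent λ k → begin
    - f (k + + 2)                          ≡⟨ cong -_ (step rf k) ⟩
    - (x * f (k + + 1) - f k)              ≡⟨ distrib x (f (k + + 1)) (f k) ⟩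
    x * - f (k + + 1) - - f k              ∎
    where
    distrib : ∀ x a b → - (x * a - b) ≡ x * - a - - b
    distrib = solve-∀

module _ {x : ℤ} {f g : ℤ → ℤ} (rf : Recurrent x f) (rg : Recurrent x g) where

  recurrent-+ : Recurrent x (λ k → f k + g k)
  recurrent-+ = recurrent λ k → begin
    f (k + + 2) + g (k + + 2)                         ≡⟨ cong₂ _+_ (step rf k) (step rg k) ⟩
    (x * f (k + + 1) - f k) + (x * g (k + + 1) - g k) ≡⟨ distrib x (f (k + + 1)) (f k) (g (k + + 1)) (g k) ⟩
    x * (f (k + + 1) + g (k + + 1)) - (f k + g k)     ∎
    where
    distrib : ∀ x a b c d → (x * a - b) + (x * c - d) ≡ x * (a + c) - (b + d)
    distrib = solve-∀

  agree-on-ℕ : f (+ 0) ≡ g (+ 0) → f (+ 1) ≡ g (+ 1) → ∀ m → f (+ m) ≡ g (+ m)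
  agree-on-ℕ e₀ e₁ m = proj₁ (agree-pair m)
    where
    +1 : ∀ m → + suc m ≡ + m + + 1
    +1 m = cong +_ (ℕ.+-comm 1 m)
    +2 : ∀ m → + suc (suc m) ≡ + m + + 2
    +2 m = cong +_ (ℕ.+-comm 2 m)
    agree-pair : ∀ m → f (+ m) ≡ g (+ m) × f (+ suc m) ≡ g (+ suc m)
    agree-pair zero = e₀ , e₁
    agree-pair (suc m) with agree-pair m
    ... | eₘ , eₘ₊₁ = eₘ₊₁ , (begin
      f (+ suc (suc m))          ≡⟨ recurrent-at rf (+1 m) (+2 m) ⟩
      x * f (+ suc m) - f (+ m)  ≡⟨ cong₂ (λ u v → x * u - v) eₘ₊₁ eₘ ⟩
      x * g (+ suc m) - g (+ m)  ≡⟨ recurrent-at rg (+1 m) (+2 m) ⟨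
      g (+ suc (suc m))          ∎)

recurrent-unique : ∀ {x} {f g : ℤ → ℤ} → Recurrent x f → Recurrent x g →
                   f (+ 0) ≡ g (+ 0) → f (+ 1) ≡ g (+ 1) → ∀ k → f k ≡ g k
recurrent-unique rf rg e₀ e₁ (+ m) = agree-on-ℕ rf rg e₀ e₁ m
recurrent-unique {x} {f} {g} rf rg e₀ e₁ -[1+ m ] =
  agree-on-ℕ (recurrent-reflect rf (+ 0)) (recurrent-reflect rg (+ 0)) e₀ e₋₁ (suc m)
  where
  e₋₁ : f -[1+ 0 ] ≡ g -[1+ 0 ]
  e₋₁ = begin
    f -[1+ 0 ]              ≡⟨ recurrent-backward rf refl refl ⟩
    x * f (+ 0) - f (+ 1)   ≡⟨ cong₂ (λ u v → x * u - v) e₀ e₁ ⟩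
    x * g (+ 0) - g (+ 1)   ≡⟨ recurrent-backward rg refl refl ⟨
    g -[1+ 0 ]              ∎

rec-two-sided-recurrent : ∀ {x a b c} {f : ℤ → ℤ} →
                          (∀ m → f (+ m) ≡ rec x a b m) → (∀ m → f -[1+ m ] ≡ rec x a c (suc m)) →
                          b ≡ x * a - c → Recurrent x f
rec-two-sided-recurrent {x} {a} {b} {c} {f} f⁺ f⁻ b≡ = recurrent step′
  where
  cancel : ∀ x u v → u ≡ x * v - (x * v - u)
  cancel = solve-∀
  step′ : ∀ k → f (k + + 2) ≡ x * f (k + + 1) - f k
  step′ (+ m) rewrite ℕ.+-comm m 2 | ℕ.+-comm m 1 | f⁺ (suc (suc m)) | f⁺ (suc m) | f⁺ m = refl
  step′ -[1+ zero ] rewrite f⁺ 1 | f⁺ 0 | f⁻ 0 = b≡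
  step′ -[1+ suc zero ] rewrite f⁺ 0 | f⁻ 0 | f⁻ 1 = cancel x a c
  step′ -[1+ suc (suc j) ] rewrite f⁻ j | f⁻ (suc j) | f⁻ (suc (suc j)) = cancel x _ _

s-recurrent : ∀ n → Recurrent n (λ k → s k n)
s-recurrent n = rec-two-sided-recurrent (λ _ → refl) (λ _ → refl) (minus-one n)
  where
  minus-one : ∀ n → n + + 1 ≡ n * + 1 - - + 1
  minus-one = solve-∀

𝒯-recurrent : ∀ x → Recurrent x (λ k → 𝒯 k x)
𝒯-recurrent x = rec-two-sided-recurrent (λ _ → refl) (λ _ → refl) (double x)
  where
  double : ∀ x → x ≡ x * + 2 - x
  double = solve-∀

s-reflect : ∀ n k → s (-[1+ 0 ] - k) n ≡ - s k n
s-reflect n = recurrent-unique (recurrent-reflect (s-recurrent n) -[1+ 0 ])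
                               (recurrent-neg (s-recurrent n)) refl (s₋₂ n)
  where
  s₋₂ : ∀ n → n * - + 1 - + 1 ≡ - (n + + 1)
  s₋₂ = solve-∀

𝒯-*-s : ∀ n a b → 𝒯 a n * s b n ≡ s (b + a) n + s (b - a) n
𝒯-*-s n a b = recurrent-unique (recurrent-*ʳ (𝒯-recurrent n) (s b n))
                               (recurrent-+ (recurrent-shift rs b) (recurrent-reflect rs b))
                               at-0 at-1 a
  where
  rs : Recurrent n (λ k → s k n)
  rs = s-recurrent n
  at-0 : + 2 * s b n ≡ s (b + + 0) n + s (b - + 0) n
  at-0 = begin
    + 2 * s b n                    ≡⟨ two-* (s b n) ⟩
    s b n + s b n                  ≡⟨ cong₂ (λ i j → s i n + s j n) b≡b+0 b≡b+0 ⟩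
    s (b + + 0) n + s (b - + 0) n  ∎
    where
    b≡b+0 : b ≡ b + + 0
    b≡b+0 = sym (+-identityʳ b)
    two-* : ∀ u → + 2 * u ≡ u + u
    two-* = solve-∀
  at-1 : n * s b n ≡ s (b + + 1) n + s (b - + 1) n
  at-1 = begin
    n * s b n                                    ≡⟨ add-back (n * s b n) (s (b - + 1) n) ⟩
    (n * s b n - s (b - + 1) n) + s (b - + 1) n  ≡⟨ cong (_+ s (b - + 1) n) s-at-b+1 ⟨
    s (b + + 1) n + s (b - + 1) n                ∎
    where
    add-back : ∀ u v → u ≡ (u - v) + v
    add-back = solve-∀
    pred-suc : ∀ b → b ≡ b - + 1 + + 1
    pred-suc = solve-∀
    pred-suc₂ : ∀ b → b + + 1 ≡ b - + 1 + + 2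
    pred-suc₂ = solve-∀
    s-at-b+1 : s (b + + 1) n ≡ n * s b n - s (b - + 1) n
    s-at-b+1 = recurrent-at rs {b - + 1} (pred-suc b) (pred-suc₂ b)

proposition21 : (p : ℤ) (h : ℤ) → p ≡ + 2 * h + + 1 → (k n : ℤ) →
    s (k + p) n - s k n ≡ 𝒯 (k + (h + + 1)) n * s h n
proposition21 p h refl k n = begin
  s (k + p) n - s k n                 ≡⟨ cong₂ _+_ (cong (λ i → s i n) (upper k h)) (s-reflect n k) ⟨
  s (h + a) n + s (-[1+ 0 ] - k) n    ≡⟨ cong (λ i → s (h + a) n + s i n) (lower k h) ⟨
  s (h + a) n + s (h - a) n           ≡⟨ 𝒯-*-s n a h ⟨
  𝒯 a n * s h n                       ∎
  where
  a : ℤ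
  a = k + (h + + 1)
  upper : ∀ k h → h + (k + (h + + 1)) ≡ k + (+ 2 * h + + 1)
  upper = solve-∀
  lower : ∀ k h → h - (k + (h + + 1)) ≡ -[1+ 0 ] - k
  lower = solve-∀
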